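{- Let $n\in\mathbb{N}$, let $\mathcal{T}_n$ be the set of ordered set partitions of $[n]$ and $\operatorname{UPF}_n$ the set of unit-interval parking functions of length $n$. Define $\psi:\mathcal{T}_n\to\operatorname{UPF}_n$ as follows: for $B_1/\cdots/B_k\in\mathcal{T}_n$, $\psi(B_1/\cdots/B_k)=(\alpha_1,\dots,\alpha_n)$ where, for each block $B_a=\{c_1<c_2<\dots<c_m\}$ with $s=|B_1|+\dots+|B_{a-1}|$, we set $\alpha_{c_1}=s+1$ and $\alpha_{c_t}=s+t-1$ for $2\le t\le m$. Define $\phi:\operatorname{UPF}_n\to\mathcal{T}_n$ as follows: for $\alpha\in\operatorname{UPF}_n$, let $\sigma(j)$ denote the car that parks in spot $j$, and let $b_1<\dots<b_k=n$ be the breakpoints of $\alpha$ ($b_0=0$); then $\phi(\alpha)=\{\sigma(1),\dots,\sigma(b_1)\}/\{\sigma(b_1+1),\dots,\sigma(b_2)\}/\cdots/\{\sigma(b_{k-1}+1),\dots,\sigma(b_k)\}$. Then $\psi$ is well defined into $\operatorname{UPF}_n$, and $\psi$ and $\phi$ are mutually inverse bijections between $\mathcal{T}_n$ and $\operatorname{UPF}_n$.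
   Context: An ordered set partition of $[n]$ is an ordered list $(B_1,\dots,B_k)$ of pairwise disjoint nonempty subsets (blocks) of $[n]$ whose union is $[n]$, written $B_1/B_2/\cdots/B_k$. A parking function of length $n$ is $\alpha=(a_1,\dots,a_n)\in[n]^n$ such that, when cars $1,\dots,n$ arrive in order on a one-way street with spots $1,\dots,n$ and car $i$ parks in the first unoccupied spot $\ge a_i$, every car parks. Car $i$'s displacement is (spot it parks in) $-a_i$; a unit-interval parking function is one in which every car has displacement at most $1$. $\alpha$ has a breakpoint at $k$ if $|\{i:a_i\le k\}|=k$. -}

module Defs where

open import Data.Nat using (ℕ; zero; suc; _+_; _∸_; _≤_; _<ᵇ_; _≤ᵇ_; _≡ᵇ_)
open import Data.Bool using (Bool; true; false; if_then_else_; _∧_)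
open import Data.Fin using (Fin; toℕ)
open import Data.List as List using (List; []; _∷_; upTo; filter)
open import Data.Bool.ListAction using (any)
open import Data.List.Relation.Unary.All using (All)
open import Data.List.Relation.Unary.AllPairs using (AllPairs)
open import Data.Vec as Vec using (Vec; []; _∷_; lookup; tabulate; toList)
open import Data.Vec.Relation.Binary.Pointwise.Inductive using (Pointwise)
open import Data.Maybe using (Maybe; just; nothing; fromMaybe)
open import Data.Product using (Σ; _×_)
open import Relation.Binary.PropositionalEquality using (_≡_)
open import Data.Fin.Subset using (Subset; _∩_; ⋃; ⊥; ⊤; ∣_∣; Nonempty)

-- Conventions: cars are indexed by Fin n (Fin index i = car i+1);
-- spots and preferences are natural numbers, spots are 1..n.
-- A preference sequence α = (a_1,…,a_n) is a Vec ℕ n.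

IsOSP : (n : ℕ) → List (Subset n) → Set
IsOSP n P =
  All Nonempty P
  × AllPairs (λ A B → A ∩ B ≡ ⊥) P
  × ⋃ P ≡ ⊤

searchFree : List ℕ → (fuel : ℕ) → (j : ℕ) → Maybe ℕ
searchFree occ zero    j = nothing
searchFree occ (suc f) j =
  if any (j ≡ᵇ_) occ then searchFree occ f (suc j) else just j

firstFree : (n : ℕ) → (occupied : List ℕ) → (a : ℕ) → Maybe ℕ
firstFree n occ a = searchFree occ (suc n ∸ a) a

parkFrom : ∀ {m} → (n : ℕ) → (occupied : List ℕ) → Vec ℕ m → Maybe (Vec ℕ m)
parkFrom n occ [] = just []
parkFrom n occ (a ∷ as) with firstFree n occ a
... | nothing = nothing
... | just p with parkFrom n (p ∷ occ) as
...   | nothing = nothing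
...   | just ps = just (p ∷ ps)

park : (n : ℕ) → Vec ℕ n → Maybe (Vec ℕ n)
park n α = parkFrom n [] α

IsParkingFunction : (n : ℕ) → Vec ℕ n → Set
IsParkingFunction n α =
  All (λ a → 1 ≤ a × a ≤ n) (toList α)
  × Σ (Vec ℕ n) (λ spots → park n α ≡ just spots)

IsUPF : (n : ℕ) → Vec ℕ n → Set
IsUPF n α =
  All (λ a → 1 ≤ a × a ≤ n) (toList α)
  × Σ (Vec ℕ n) (λ spots → park n α ≡ just spots
                           × Pointwise (λ p a → p ≤ suc a) spots α)

psiAux : ∀ {n} → (s : ℕ) → List (Subset n) → Fin n → ℕ
psiAux s []       c = 0
psiAux s (B ∷ Bs) c =
  if lookup B c
  then (let t = ∣ B ∩ tabulate (λ d → toℕ d ≤ᵇ toℕ c) ∣ in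
        if t ≡ᵇ 1 then s + 1 else s + t ∸ 1)
  else psiAux (s + ∣ B ∣) Bs c

psi : ∀ {n} → List (Subset n) → Vec ℕ n
psi P = tabulate (psiAux 0 P)

countLE : ∀ {n} → Vec ℕ n → ℕ → ℕ
countLE α k = List.length (filter (λ a → a Data.Nat.≤? k) (toList α))
  where import Data.Nat

breakpoints : ∀ {n} → Vec ℕ n → List ℕ
breakpoints {n} α =
  filter (λ k → countLE α k Data.Nat.≟ k) (List.map suc (upTo n))
  where import Data.Nat

-- spot of each car (junk value 0 everywhere if parking fails)
spotsOf : ∀ {n} → Vec ℕ n → Vec ℕ n
spotsOf {n} α = fromMaybe (Vec.replicate n 0) (park n α)

-- {σ(lo+1), …, σ(hi)} = the set of cars whose spot lies in (lo, hi]
carsIn : ∀ {n} → Vec ℕ n → (lo hi : ℕ) → Subset n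
carsIn α lo hi = Vec.map (λ p → (lo <ᵇ p) ∧ (p ≤ᵇ hi)) (spotsOf α)

phiBlocks : ∀ {n} → Vec ℕ n → (lo : ℕ) → List ℕ → List (Subset n)
phiBlocks α lo []       = []
phiBlocks α lo (b ∷ bs) = carsIn α lo b ∷ phiBlocks α b bs

phi : ∀ {n} → Vec ℕ n → List (Subset n)
phi α = phiBlocks α 0 (breakpoints α)

-- Write p c for the spot of car c.  In a unit-interval parking function car c parks at a c or a c + 1,
-- and it parks at its preference exactly when p c − 1 is a breakpoint.  Between two consecutive
-- breakpoints lo < b every car but the one at lo + 1 is displaced into a spot whose left neighbour
-- was taken by an earlier car, so there the cars arrive in the order of their spots.  Hence φ's block
-- (lo, b] has its t-th smallest car at spot lo + t, preferring lo + 1 if t = 1 and lo + t − 1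
-- otherwise, which is ψ ∘ φ = id.  Conversely ψ parks the t-th car of a block B with s earlier
-- elements at s + t (its predecessor in B fills s + t − 1), and the breakpoints are exactly the
-- partial sums s, which gives φ ∘ ψ = id.
module Submission where

open import Defs
open import Data.Nat
  using (ℕ; zero; suc; _+_; _∸_; _≤_; _<_; _≤ᵇ_; _<ᵇ_; _≡ᵇ_; _≤?_; _<?_; _≟_; z≤n; s≤s)
open import Data.Nat.Properties
open import Algebra.Properties.CommutativeSemigroup +-commutativeSemigroup using (interchange)
open import Data.Bool using (Bool; true; false; if_then_else_; _∧_; _∨_; not)
open import Data.Bool.Properties using (∧-identityʳ; ∧-zeroʳ; ∨-zeroʳ; T-≡)
import Data.Bool as Bool
open import Data.Bool.ListAction using (any)
open import Data.Fin using (Fin; zero; suc; toℕ)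
import Data.Fin.Properties as Fin
open import Data.List as List using (List; []; _∷_; filter; applyUpTo)
import Data.List.Properties as Listₚ
open import Data.List.Membership.Propositional using (_∈_; _∉_)
open import Data.List.Relation.Unary.Any using (here; there)
open import Data.List.Relation.Unary.All as All using (All; []; _∷_)
open import Data.List.Relation.Unary.AllPairs as AllPairs using (AllPairs; []; _∷_)
open import Data.Vec using (Vec; []; _∷_; lookup; tabulate; toList)
import Data.Vec.Properties as Vec
import Data.Vec.Relation.Binary.Pointwise.Inductive as Pointwise
open import Data.Vec.Functional using (tail)
open import Data.Maybe using (just; nothing)
open import Data.Fin.Subset using (Subset; _∩_; ⋃; ⊥; ⊤; ∣_∣; Nonempty)
open import Data.Product using (∃; ∃₂; _×_; _,_; proj₁; proj₂; uncurry)
open import Data.Sum using (_⊎_; inj₁; inj₂)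
open import Data.Empty using (⊥-elim)
open import Relation.Nullary using (¬_; Dec; yes; no)
open import Relation.Nullary.Decidable using (_×-dec_)
open import Relation.Binary.Definitions using (tri<; tri≈; tri>)
open import Relation.Binary.PropositionalEquality
open import Function using (_∘′_; Equivalence)

private
  variable
    m n : ℕ

false≢true : false ≢ true
false≢true ()

≤⇒≤ᵇ≡true : m ≤ n → (m ≤ᵇ n) ≡ true
≤⇒≤ᵇ≡true m≤n = Equivalence.to T-≡ (≤⇒≤ᵇ m≤n)

≤ᵇ≡true⇒≤ : (m ≤ᵇ n) ≡ true → m ≤ n
≤ᵇ≡true⇒≤ {m} {n} e = ≤ᵇ⇒≤ m n (Equivalence.from T-≡ e)

>⇒≤ᵇ≡false : n < m → (m ≤ᵇ n) ≡ false
>⇒≤ᵇ≡false {n} {m} n<m with m ≤ᵇ n in e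
... | false = refl
... | true  = ⊥-elim (<⇒≱ n<m (≤ᵇ≡true⇒≤ e))

<⇒<ᵇ≡true : m < n → (m <ᵇ n) ≡ true
<⇒<ᵇ≡true m<n = Equivalence.to T-≡ (<⇒<ᵇ m<n)

<ᵇ≡true⇒< : (m <ᵇ n) ≡ true → m < n
<ᵇ≡true⇒< {m} {n} e = <ᵇ⇒< m n (Equivalence.from T-≡ e)

≥⇒<ᵇ≡false : n ≤ m → (m <ᵇ n) ≡ false
≥⇒<ᵇ≡false {n} {m} n≤m with m <ᵇ n in e
... | false = refl
... | true  = ⊥-elim (<⇒≱ (<ᵇ≡true⇒< e) n≤m)

≡⇒≡ᵇ≡true : m ≡ n → (m ≡ᵇ n) ≡ true
≡⇒≡ᵇ≡true {m} {n} m≡n = Equivalence.to T-≡ (≡⇒≡ᵇ m n m≡n)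

≡ᵇ≡true⇒≡ : (m ≡ᵇ n) ≡ true → m ≡ n
≡ᵇ≡true⇒≡ {m} {n} e = ≡ᵇ⇒≡ m n (Equivalence.from T-≡ e)

≢⇒≡ᵇ≡false : m ≢ n → (m ≡ᵇ n) ≡ false
≢⇒≡ᵇ≡false {m} {n} m≢n with m ≡ᵇ n in e
... | false = refl
... | true  = ⊥-elim (m≢n (≡ᵇ≡true⇒≡ e))

∧≡true⇒ˡ : ∀ {a b} → (a ∧ b) ≡ true → a ≡ true
∧≡true⇒ˡ {true} _ = refl

∧≡true⇒ʳ : ∀ {a b} → (a ∧ b) ≡ true → b ≡ true
∧≡true⇒ʳ {true} e = e

∧≡true : ∀ {a b} → a ≡ true → b ≡ true → (a ∧ b) ≡ true
∧≡true refl refl = refl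

∨≡true⇒ʳ : ∀ {a b} → (a ∨ b) ≡ true → a ≡ false → b ≡ true
∨≡true⇒ʳ e refl = e

indicator : Bool → ℕ
indicator true  = 1
indicator false = 0

count : (Fin n → Bool) → ℕ
count {zero}  f = 0
count {suc n} f = indicator (f zero) + count (tail f)

count-cong : {f g : Fin n → Bool} → (∀ i → f i ≡ g i) → count f ≡ count g
count-cong {zero}  _   = refl
count-cong {suc n} f≗g = cong₂ _+_ (cong indicator (f≗g zero)) (count-cong (λ i → f≗g (suc i)))

indicator-mono : ∀ {a b} → (a ≡ true → b ≡ true) → indicator a ≤ indicator b
indicator-mono {false} _   = z≤n
indicator-mono {true}  a⇒b rewrite a⇒b refl = ≤-refl

count-mono : {f g : Fin n → Bool} → (∀ i → f i ≡ true → g i ≡ true) → count f ≤ count g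
count-mono {zero}  _   = z≤n
count-mono {suc n} f⊆g = +-mono-≤ (indicator-mono (f⊆g zero)) (count-mono (λ i → f⊆g (suc i)))

count-mono-< : {f g : Fin n → Bool} (c : Fin n) → (∀ i → f i ≡ true → g i ≡ true) →
               f c ≡ false → g c ≡ true → count f < count g
count-mono-< zero    f⊆g fc gc rewrite fc | gc = s≤s (count-mono (λ i → f⊆g (suc i)))
count-mono-< (suc c) f⊆g fc gc =
  +-mono-≤-< (indicator-mono (f⊆g zero)) (count-mono-< c (λ i → f⊆g (suc i)) fc gc)

count-witness : {f : Fin n → Bool} → 0 < count f → ∃ λ i → f i ≡ true
count-witness {suc n} {f} pos with f zero in e
... | true  = zero , e
... | false = let (i , fi) = count-witness {f = tail f} pos in suc i , fi

count-≥1 : {f : Fin n → Bool} (c : Fin n) → f c ≡ true → 1 ≤ count f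
count-≥1 {f = f} zero    fc rewrite fc = s≤s z≤n
count-≥1 {f = f} (suc c) fc = ≤-trans (count-≥1 {f = tail f} c fc) (m≤n+m _ (indicator (f zero)))

count-all-true : (f : Fin n → Bool) → (∀ i → f i ≡ true) → count f ≡ n
count-all-true {zero}  f _ = refl
count-all-true {suc n} f t rewrite t zero = cong suc (count-all-true (tail f) (λ i → t (suc i)))

count-all-false : (f : Fin n → Bool) → (∀ i → f i ≡ false) → count f ≡ 0
count-all-false {zero}  f _ = refl
count-all-false {suc n} f t rewrite t zero = count-all-false (tail f) (λ i → t (suc i))

count-remove : {f g : Fin n → Bool} (c : Fin n) → (∀ i → i ≢ c → f i ≡ g i) →
               f c ≡ true → g c ≡ false → count f ≡ suc (count g)
count-remove zero f≗g fc gc rewrite fc | gc = cong suc (count-cong (λ i → f≗g (suc i) (λ ())))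
count-remove {g = g} (suc c) f≗g fc gc =
  trans (cong₂ _+_ (cong indicator (f≗g zero (λ ())))
                   (count-remove c (λ i i≢c → f≗g (suc i) (i≢c ∘′ Fin.suc-injective)) fc gc))
        (+-suc (indicator (g zero)) _)

indicator-not : ∀ b → indicator b + indicator (not b) ≡ 1
indicator-not true  = refl
indicator-not false = refl

count-complement : (f : Fin n → Bool) → count f + count (not ∘′ f) ≡ n
count-complement {zero}  f = refl
count-complement {suc n} f =
  trans (interchange (indicator (f zero)) _ (indicator (not (f zero))) _)
        (cong₂ _+_ (indicator-not (f zero)) (count-complement (tail f)))

indicator-∨ : ∀ a b → (a ∧ b) ≡ false → indicator (a ∨ b) ≡ indicator a + indicator b
indicator-∨ true  false _ = refl
indicator-∨ false b     _ = refl

count-∨-disjoint : (f g : Fin n → Bool) → (∀ i → (f i ∧ g i) ≡ false) →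
                   count (λ i → f i ∨ g i) ≡ count f + count g
count-∨-disjoint {zero}  f g _ = refl
count-∨-disjoint {suc n} f g disjoint =
  trans (cong₂ _+_ (indicator-∨ (f zero) (g zero) (disjoint zero))
                   (count-∨-disjoint (tail f) (tail g) (λ i → disjoint (suc i))))
        (interchange (indicator (f zero)) (indicator (g zero)) _ _)

-- counts the j ∈ {1, …, M} (not {0, …, M − 1}) with h j
countUpTo : (ℕ → Bool) → ℕ → ℕ
countUpTo h zero    = 0
countUpTo h (suc M) = indicator (h (suc M)) + countUpTo h M

countUpTo-cong : ∀ {h h′ : ℕ → Bool} M → (∀ j → 1 ≤ j → j ≤ M → h j ≡ h′ j) →
                 countUpTo h M ≡ countUpTo h′ M
countUpTo-cong zero    _    = refl
countUpTo-cong (suc M) h≗h′ =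
  cong₂ _+_ (cong indicator (h≗h′ (suc M) (s≤s z≤n) ≤-refl))
            (countUpTo-cong M (λ j 1≤j j≤M → h≗h′ j 1≤j (m≤n⇒m≤1+n j≤M)))

countUpTo-complement : ∀ (h : ℕ → Bool) M → countUpTo h M + countUpTo (not ∘′ h) M ≡ M
countUpTo-complement h zero    = refl
countUpTo-complement h (suc M) =
  trans (interchange (indicator (h (suc M))) _ (indicator (not (h (suc M)))) _)
        (cong₂ _+_ (indicator-not (h (suc M))) (countUpTo-complement h M))

countUpTo-true : ∀ M → countUpTo (λ _ → true) M ≡ M
countUpTo-true zero    = refl
countUpTo-true (suc M) = cong suc (countUpTo-true M)

countUpTo-remove : ∀ (h : ℕ → Bool) x M → h x ≡ true → 1 ≤ x → x ≤ M →
                   countUpTo h M ≡ suc (countUpTo (λ j → h j ∧ not (j ≡ᵇ x)) M)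
countUpTo-remove h x zero    _  1≤x x≤0 = ⊥-elim (<⇒≱ 1≤x x≤0)
countUpTo-remove h x (suc M) hx 1≤x x≤1+M with m≤n⇒m<n∨m≡n x≤1+M
... | inj₂ refl rewrite hx | ≡⇒≡ᵇ≡true (refl {x = suc M}) =
  cong suc (countUpTo-cong M (λ j _ j≤M →
    sym (trans (cong (λ b → h j ∧ not b) (≢⇒≡ᵇ≡false (<⇒≢ (s≤s j≤M)))) (∧-identityʳ (h j)))))
... | inj₁ (s≤s x≤M) rewrite ≢⇒≡ᵇ≡false (<⇒≢ (s≤s x≤M) ∘′ sym) | ∧-identityʳ (h (suc M)) =
  trans (cong (indicator (h (suc M)) +_) (countUpTo-remove h x M hx 1≤x x≤M))
        (+-suc (indicator (h (suc M))) _)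

inInterval : ℕ → ℕ → ℕ → Bool
inInterval lo hi j = (lo <ᵇ j) ∧ (j ≤ᵇ hi)

countUpTo-interval : ∀ M lo hi → hi ≤ M → countUpTo (inInterval lo hi) M ≡ hi ∸ lo
countUpTo-interval M lo hi hi≤M with m≤n⇒m<n∨m≡n hi≤M
... | inj₂ refl = up-to-hi M ≤-refl
  where
  up-to-hi : ∀ M → M ≤ hi → countUpTo (inInterval lo hi) M ≡ M ∸ lo
  up-to-hi zero    _ = sym (0∸n≡0 lo)
  up-to-hi (suc M) 1+M≤hi
    rewrite ≤⇒≤ᵇ≡true 1+M≤hi | ∧-identityʳ (lo <ᵇ suc M) | up-to-hi M (≤-trans (n≤1+n M) 1+M≤hi)
    with lo ≤? M
  ... | yes lo≤M rewrite <⇒<ᵇ≡true (s≤s lo≤M) = sym (+-∸-assoc 1 lo≤M)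
  ... | no  lo≰M rewrite ≥⇒<ᵇ≡false {suc M} {lo} (≰⇒> lo≰M) =
    trans (m≤n⇒m∸n≡0 (≤-trans (n≤1+n M) (≰⇒> lo≰M))) (sym (m≤n⇒m∸n≡0 (≰⇒> lo≰M)))
countUpTo-interval (suc M) lo hi _ | inj₁ (s≤s hi≤M)
  rewrite >⇒≤ᵇ≡false {hi} {suc M} (s≤s hi≤M) | ∧-zeroʳ (lo <ᵇ suc M) = countUpTo-interval M lo hi hi≤M

pigeonhole : ∀ M (f : Fin n → Bool) (p : Fin n → ℕ) (h : ℕ → Bool) →
             (∀ i j → f i ≡ true → f j ≡ true → p i ≡ p j → i ≡ j) →
             (∀ i → f i ≡ true → 1 ≤ p i × p i ≤ M × h (p i) ≡ true) →
             count f ≤ countUpTo h M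
pigeonhole {zero}  M f p h _   _    = z≤n
pigeonhole {suc n} M f p h inj maps with f zero in f0
... | false = pigeonhole M (tail f) (tail p) h inj-tail (λ i → maps (suc i))
  where
  inj-tail : ∀ i j → f (suc i) ≡ true → f (suc j) ≡ true → p (suc i) ≡ p (suc j) → i ≡ j
  inj-tail i j fi fj = Fin.suc-injective ∘′ inj (suc i) (suc j) fi fj
... | true  =
  let (1≤p0 , p0≤M , hp0) = maps zero f0 in
  subst (suc (count (tail f)) ≤_) (sym (countUpTo-remove h (p zero) M hp0 1≤p0 p0≤M))
    (s≤s (pigeonhole M (tail f) (tail p) (λ j → h j ∧ not (j ≡ᵇ p zero)) inj-tail maps-tail))
  where
  inj-tail : ∀ i j → f (suc i) ≡ true → f (suc j) ≡ true → p (suc i) ≡ p (suc j) → i ≡ j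
  inj-tail i j fi fj = Fin.suc-injective ∘′ inj (suc i) (suc j) fi fj
  p≢p0 : ∀ i → f (suc i) ≡ true → p (suc i) ≢ p zero
  p≢p0 i fi pi≡p0 = Fin.0≢1+n (sym (inj (suc i) zero fi f0 pi≡p0))
  maps-tail : ∀ i → f (suc i) ≡ true →
              1 ≤ p (suc i) × p (suc i) ≤ M × (h (p (suc i)) ∧ not (p (suc i) ≡ᵇ p zero)) ≡ true
  maps-tail i fi = let (1≤pi , pi≤M , hpi) = maps (suc i) fi in
                   1≤pi , pi≤M , ∧≡true hpi (cong not (≢⇒≡ᵇ≡false (p≢p0 i fi)))

count∘bijection : (p : Fin n → ℕ) → (∀ i j → p i ≡ p j → i ≡ j) → (∀ i → 1 ≤ p i × p i ≤ n) →
                  ∀ (h : ℕ → Bool) → count (h ∘′ p) ≡ countUpTo h n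
count∘bijection {n} p inj range h = ≤-antisym upper lower
  where
  upper : count (h ∘′ p) ≤ countUpTo h n
  upper = pigeonhole n (h ∘′ p) p h (λ i j _ _ → inj i j) (λ i hpi → proj₁ (range i) , proj₂ (range i) , hpi)
  upper′ : count (not ∘′ h ∘′ p) ≤ countUpTo (not ∘′ h) n
  upper′ = pigeonhole n (not ∘′ h ∘′ p) p (not ∘′ h) (λ i j _ _ → inj i j)
                      (λ i hpi → proj₁ (range i) , proj₂ (range i) , hpi)
  lower : countUpTo h n ≤ count (h ∘′ p)
  lower = +-cancelʳ-≤ _ _ _ (begin
    countUpTo h n + count (not ∘′ h ∘′ p)     ≤⟨ +-monoʳ-≤ (countUpTo h n) upper′ ⟩
    countUpTo h n + countUpTo (not ∘′ h) n    ≡⟨ countUpTo-complement h n ⟩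
    n                                         ≡⟨ count-complement (h ∘′ p) ⟨
    count (h ∘′ p) + count (not ∘′ h ∘′ p)    ∎)
    where open ≤-Reasoning

-- The parking process

any-≡ᵇ⇒∈ : ∀ j (occ : List ℕ) → any (j ≡ᵇ_) occ ≡ true → j ∈ occ
any-≡ᵇ⇒∈ j (x ∷ occ) e with j ≡ᵇ x in j≡ᵇx
... | true  = here (≡ᵇ≡true⇒≡ j≡ᵇx)
... | false = there (any-≡ᵇ⇒∈ j occ e)

∈⇒any-≡ᵇ : ∀ j (occ : List ℕ) → j ∈ occ → any (j ≡ᵇ_) occ ≡ true
∈⇒any-≡ᵇ j (x ∷ occ) (here refl) rewrite ≡⇒≡ᵇ≡true (refl {x = j}) = refl
∈⇒any-≡ᵇ j (x ∷ occ) (there j∈occ) rewrite ∈⇒any-≡ᵇ j occ j∈occ with j ≡ᵇ x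
... | true  = refl
... | false = refl

FirstFree : List ℕ → ℕ → ℕ → Set
FirstFree occ a p = a ≤ p × p ∉ occ × (∀ x → a ≤ x → x < p → x ∈ occ)

searchFree-sound : ∀ occ f j p → searchFree occ f j ≡ just p → FirstFree occ j p × p < j + f
searchFree-sound occ zero    j p ()
searchFree-sound occ (suc f) j p e with any (j ≡ᵇ_) occ in j∈?occ
... | false with e
... | refl = ( ≤-refl
             , (λ j∈occ → false≢true (trans (sym j∈?occ) (∈⇒any-≡ᵇ j occ j∈occ)))
             , (λ x j≤x x<j → ⊥-elim (<⇒≱ x<j j≤x)))
           , subst (j <_) (sym (+-suc j f)) (s≤s (m≤m+n j f))
searchFree-sound occ (suc f) j p e | true =
  let ((1+j≤p , p∉occ , below) , p<1+j+f) = searchFree-sound occ f (suc j) p e in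
  (≤-trans (n≤1+n j) 1+j≤p , p∉occ , taken below) , subst (p <_) (sym (+-suc j f)) p<1+j+f
  where
  taken : (∀ x → suc j ≤ x → x < p → x ∈ occ) → ∀ x → j ≤ x → x < p → x ∈ occ
  taken below x j≤x x<p with m≤n⇒m<n∨m≡n j≤x
  ... | inj₁ j<x  = below x j<x x<p
  ... | inj₂ refl = any-≡ᵇ⇒∈ j occ j∈?occ

searchFree-complete : ∀ occ f j p → FirstFree occ j p → p < j + f → searchFree occ f j ≡ just p
searchFree-complete occ zero    j p (j≤p , _) p<j+0 = ⊥-elim (<⇒≱ p<j+0 (subst (_≤ p) (sym (+-identityʳ j)) j≤p))
searchFree-complete occ (suc f) j p (j≤p , p∉occ , below) p<j+1+f with m≤n⇒m<n∨m≡n j≤p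
... | inj₂ refl with any (j ≡ᵇ_) occ in j∈?occ
...   | true  = ⊥-elim (p∉occ (any-≡ᵇ⇒∈ j occ j∈?occ))
...   | false = refl
searchFree-complete occ (suc f) j p (j≤p , p∉occ , below) p<j+1+f | inj₁ j<p
  rewrite ∈⇒any-≡ᵇ j occ (below j ≤-refl j<p) =
  searchFree-complete occ f (suc j) p (j<p , p∉occ , λ x 1+j≤x → below x (≤-trans (n≤1+n j) 1+j≤x))
                      (subst (p <_) (+-suc j f) p<j+1+f)

firstFree-sound : ∀ n occ a p → firstFree n occ a ≡ just p → FirstFree occ a p × p ≤ n
firstFree-sound n occ a p e =
  let (first , p<a+fuel) = searchFree-sound occ (suc n ∸ a) a p e in first , bounded (proj₁ first) p<a+fuel
  where
  bounded : a ≤ p → p < a + (suc n ∸ a) → p ≤ n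
  bounded a≤p p<a+fuel with a ≤? suc n
  ... | yes a≤1+n = ≤-pred (subst (p <_) (m+[n∸m]≡n a≤1+n) p<a+fuel)
  ... | no  a≰1+n rewrite m≤n⇒m∸n≡0 (<⇒≤ (≰⇒> a≰1+n)) | +-identityʳ a = ⊥-elim (<⇒≱ p<a+fuel a≤p)

firstFree-complete : ∀ n occ a p → FirstFree occ a p → p ≤ n → firstFree n occ a ≡ just p
firstFree-complete n occ a p first p≤n =
  searchFree-complete occ (suc n ∸ a) a p first
    (subst (p <_) (sym (m+[n∸m]≡n (≤-trans (proj₁ first) (m≤n⇒m≤1+n p≤n)))) (s≤s p≤n))

Occupied : List ℕ → Vec ℕ m → Fin m → ℕ → Set
Occupied occ ps i x = x ∈ occ ⊎ ∃ λ j → toℕ j < toℕ i × lookup ps j ≡ x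

record CarParks (n : ℕ) (occ : List ℕ) (as ps : Vec ℕ m) (i : Fin m) : Set where
  constructor mkCarParks
  field
    preference≤spot : lookup as i ≤ lookup ps i
    spot≤n          : lookup ps i ≤ n
    spot-free       : ¬ Occupied occ ps i (lookup ps i)
    passed-occupied : ∀ x → lookup as i ≤ x → x < lookup ps i → Occupied occ ps i x

ParksAt : ℕ → List ℕ → Vec ℕ m → Vec ℕ m → Set
ParksAt n occ as ps = ∀ i → CarParks n occ as ps i

Occupied-push : ∀ {occ p} {ps : Vec ℕ m} {i x} → Occupied (p ∷ occ) ps i x → Occupied occ (p ∷ ps) (suc i) x
Occupied-push (inj₁ (here refl))      = inj₂ (zero , s≤s z≤n , refl)
Occupied-push (inj₁ (there x∈occ))    = inj₁ x∈occ
Occupied-push (inj₂ (j , j<i , psj)) = inj₂ (suc j , s≤s j<i , psj)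

Occupied-pop : ∀ {occ p} {ps : Vec ℕ m} {i x} → Occupied occ (p ∷ ps) (suc i) x → Occupied (p ∷ occ) ps i x
Occupied-pop (inj₁ x∈occ)                  = inj₁ (there x∈occ)
Occupied-pop (inj₂ (zero , _ , p≡x))        = inj₁ (here (sym p≡x))
Occupied-pop (inj₂ (suc j , s≤s j<i , psj)) = inj₂ (j , j<i , psj)

Occupied-first : ∀ {occ} {ps : Vec ℕ (suc m)} {x} → Occupied occ ps zero x → x ∈ occ
Occupied-first (inj₁ x∈occ)       = x∈occ
Occupied-first (inj₂ (_ , () , _))

parkFrom-∷ : ∀ n occ a (as : Vec ℕ m) ps → parkFrom n occ (a ∷ as) ≡ just ps →
  ∃₂ λ p ps′ → ps ≡ p ∷ ps′ × firstFree n occ a ≡ just p × parkFrom n (p ∷ occ) as ≡ just ps′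
parkFrom-∷ n occ a as ps e with firstFree n occ a in ff
... | nothing with e
...   | ()
parkFrom-∷ n occ a as ps e | just p with parkFrom n (p ∷ occ) as in rest
... | nothing with e
...   | ()
parkFrom-∷ n occ a as ps e | just p | just ps′ with e
... | refl = p , ps′ , refl , refl , rest

parkFrom-sound : ∀ n occ (as ps : Vec ℕ m) → parkFrom n occ as ≡ just ps → ParksAt n occ as ps
parkFrom-sound n occ (a ∷ as) ps e i with parkFrom-∷ n occ a as ps e
parkFrom-sound n occ (a ∷ as) ps e zero    | p , ps′ , refl , ff , _ =
  let ((a≤p , p∉occ , below) , p≤n) = firstFree-sound n occ a p ff in
  mkCarParks a≤p p≤n (p∉occ ∘′ Occupied-first {ps = p ∷ ps′}) (λ x a≤x x<p → inj₁ (below x a≤x x<p))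
parkFrom-sound n occ (a ∷ as) ps e (suc i) | p , ps′ , refl , _ , rest =
  let mkCarParks a≤p p≤n free below = parkFrom-sound n (p ∷ occ) as ps′ rest i in
  mkCarParks a≤p p≤n (free ∘′ Occupied-pop) (λ x a≤x x<p → Occupied-push (below x a≤x x<p))

ParksAt-head : ∀ {n occ a p} {as ps : Vec ℕ m} → ParksAt n occ (a ∷ as) (p ∷ ps) → FirstFree occ a p × p ≤ n
ParksAt-head {ps = ps} parks =
  let mkCarParks a≤p p≤n free below = parks zero in
  (a≤p , free ∘′ inj₁ , λ x a≤x x<p → Occupied-first {ps = _ ∷ ps} (below x a≤x x<p)) , p≤n

ParksAt-tail : ∀ {n occ a p} {as ps : Vec ℕ m} → ParksAt n occ (a ∷ as) (p ∷ ps) → ParksAt n (p ∷ occ) as ps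
ParksAt-tail parks i =
  let mkCarParks a≤p p≤n free below = parks (suc i) in
  mkCarParks a≤p p≤n (free ∘′ Occupied-push) (λ x a≤x x<p → Occupied-pop (below x a≤x x<p))

parkFrom-complete : ∀ n occ (as ps : Vec ℕ m) → ParksAt n occ as ps → parkFrom n occ as ≡ just ps
parkFrom-complete n occ []       []       _     = refl
parkFrom-complete n occ (a ∷ as) (p ∷ ps) parks
  rewrite uncurry (firstFree-complete n occ a p) (ParksAt-head parks)
        | parkFrom-complete n (p ∷ occ) as ps (ParksAt-tail parks) = refl

All-toList⇒lookup : ∀ {P : ℕ → Set} (v : Vec ℕ n) → All P (toList v) → ∀ i → P (lookup v i)
All-toList⇒lookup (x ∷ v) (px ∷ _)  zero    = px
All-toList⇒lookup (x ∷ v) (_  ∷ pv) (suc i) = All-toList⇒lookup v pv i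

lookup⇒All-toList : ∀ {P : ℕ → Set} (v : Vec ℕ n) → (∀ i → P (lookup v i)) → All P (toList v)
lookup⇒All-toList []      _  = []
lookup⇒All-toList (x ∷ v) pv = pv zero ∷ lookup⇒All-toList v (λ i → pv (suc i))

lookup-extensionality : ∀ {A : Set} (u v : Vec A n) → (∀ i → lookup u i ≡ lookup v i) → u ≡ v
lookup-extensionality u v u≗v = trans (sym (Vec.tabulate∘lookup u)) (trans (Vec.tabulate-cong u≗v) (Vec.tabulate∘lookup v))

∣∣≡count : (S : Subset n) → ∣ S ∣ ≡ count (lookup S)
∣∣≡count []          = refl
∣∣≡count (true ∷ S)  = cong suc (∣∣≡count S)
∣∣≡count (false ∷ S) = ∣∣≡count S

countLE≡count : (v : Vec ℕ n) (k : ℕ) → countLE v k ≡ count (λ i → lookup v i ≤ᵇ k)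
countLE≡count []      k = refl
countLE≡count (x ∷ v) k with x ≤? k
... | yes x≤k rewrite ≤⇒≤ᵇ≡true x≤k = cong suc (countLE≡count v k)
... | no  x≰k rewrite >⇒≤ᵇ≡false (≰⇒> x≰k) = countLE≡count v k

lookup-∩ : (A B : Subset n) (i : Fin n) → lookup (A ∩ B) i ≡ (lookup A i ∧ lookup B i)
lookup-∩ A B i = Vec.lookup-zipWith _∧_ i A B

lookup-⋃-∷ : (B : Subset n) (Bs : List (Subset n)) (i : Fin n) → lookup (⋃ (B ∷ Bs)) i ≡ (lookup B i ∨ lookup (⋃ Bs) i)
lookup-⋃-∷ B Bs i = Vec.lookup-zipWith _∨_ i B (⋃ Bs)

lookup-⊥ : (i : Fin n) → lookup (⊥ {n}) i ≡ false
lookup-⊥ i = Vec.lookup-replicate i false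

lookup-⊤ : (i : Fin n) → lookup (⊤ {n}) i ≡ true
lookup-⊤ i = Vec.lookup-replicate i true

Nonempty⇒∣∣≥1 : (B : Subset n) → Nonempty B → 1 ≤ ∣ B ∣
Nonempty⇒∣∣≥1 B (c , c∈B) = subst (1 ≤_) (sym (∣∣≡count B)) (count-≥1 c (Vec.[]=⇒lookup c∈B))

rank : Subset n → Fin n → ℕ
rank B c = ∣ B ∩ tabulate (λ d → toℕ d ≤ᵇ toℕ c) ∣

psiValue : ℕ → ℕ → ℕ
psiValue s t = if t ≡ᵇ 1 then s + 1 else s + t ∸ 1

psiValue-1 : ∀ s → psiValue s 1 ≡ suc s
psiValue-1 s = +-comm s 1

psiValue-≥2 : ∀ s t → 2 ≤ t → psiValue s t ≡ s + t ∸ 1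
psiValue-≥2 s (suc zero)    (s≤s ())
psiValue-≥2 s (suc (suc t)) _ = refl

psiValue-≥2′ : ∀ s t → 2 ≤ t → psiValue s t ≡ s + (t ∸ 1)
psiValue-≥2′ s (suc zero)    (s≤s ())
psiValue-≥2′ s (suc (suc t)) _ = +-∸-assoc s {suc (suc t)} (s≤s z≤n)

psiValue≤ : ∀ s t → psiValue s t ≤ s + t
psiValue≤ s zero          = m∸n≤m (s + 0) 1
psiValue≤ s (suc zero)    = ≤-refl
psiValue≤ s (suc (suc t)) = m∸n≤m (s + suc (suc t)) 1

psiValue-≥1 : ∀ s t → 1 ≤ t → 1 ≤ psiValue s t
psiValue-≥1 s (suc zero)    _ = subst (1 ≤_) (+-comm 1 s) (s≤s z≤n)
psiValue-≥1 s (suc (suc t)) _ rewrite +-suc s (suc t) | +-suc s t = s≤s z≤n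

≤1+psiValue : ∀ s t → 1 ≤ t → s + t ≤ suc (psiValue s t)
≤1+psiValue s (suc zero)    _ = n≤1+n _
≤1+psiValue s (suc (suc t)) _ rewrite +-suc s (suc t) = ≤-refl

psiValue≡⇒t≡1 : ∀ s t → 1 ≤ t → psiValue s t ≡ s + t → t ≡ 1
psiValue≡⇒t≡1 s (suc zero)    _ _ = refl
psiValue≡⇒t≡1 s (suc (suc t)) _ e rewrite +-suc s (suc t) = ⊥-elim (1+n≢n (sym e))

psiAux-here : ∀ s (B : Subset n) Bs c → lookup B c ≡ true →
              psiAux s (B ∷ Bs) c ≡ psiValue s (rank B c)
psiAux-here s B Bs c c∈B rewrite c∈B = refl

psiAux-there : ∀ s (B : Subset n) Bs c → lookup B c ≡ false → psiAux s (B ∷ Bs) c ≡ psiAux (s + ∣ B ∣) Bs c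
psiAux-there s B Bs c c∉B rewrite c∉B = refl

rank≡count : (B : Subset n) (c : Fin n) → rank B c ≡ count (λ d → lookup B d ∧ (toℕ d ≤ᵇ toℕ c))
rank≡count B c = trans (∣∣≡count (B ∩ tabulate (λ d → toℕ d ≤ᵇ toℕ c)))
  (count-cong (λ d → trans (lookup-∩ B _ d) (cong (lookup B d ∧_) (Vec.lookup∘tabulate (λ d → toℕ d ≤ᵇ toℕ c) d))))

rank-≥1 : (B : Subset n) (c : Fin n) → lookup B c ≡ true → 1 ≤ rank B c
rank-≥1 B c c∈B = subst (1 ≤_) (sym (rank≡count B c)) (count-≥1 c (∧≡true c∈B (≤⇒≤ᵇ≡true (≤-refl {toℕ c}))))

rank≤∣∣ : (B : Subset n) (c : Fin n) → rank B c ≤ ∣ B ∣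
rank≤∣∣ B c = subst₂ _≤_ (sym (rank≡count B c)) (sym (∣∣≡count B))
  (count-mono {f = λ d → lookup B d ∧ (toℕ d ≤ᵇ toℕ c)} {g = lookup B} (λ _ → ∧≡true⇒ˡ))

rank-mono-< : (B : Subset n) (c d : Fin n) → lookup B c ≡ true → toℕ d < toℕ c → rank B d < rank B c
rank-mono-< B c d c∈B d<c = subst₂ _<_ (sym (rank≡count B d)) (sym (rank≡count B c))
  (count-mono-< {f = λ i → lookup B i ∧ (toℕ i ≤ᵇ toℕ d)} {g = λ i → lookup B i ∧ (toℕ i ≤ᵇ toℕ c)}
    c below≤d⇒below≤c
    (trans (cong (lookup B c ∧_) (>⇒≤ᵇ≡false d<c)) (∧-zeroʳ _))
    (∧≡true c∈B (≤⇒≤ᵇ≡true (≤-refl {toℕ c}))))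
  where
  below≤d⇒below≤c : ∀ i → (lookup B i ∧ (toℕ i ≤ᵇ toℕ d)) ≡ true →
                          (lookup B i ∧ (toℕ i ≤ᵇ toℕ c)) ≡ true
  below≤d⇒below≤c i e =
    ∧≡true (∧≡true⇒ˡ e) (≤⇒≤ᵇ≡true (≤-trans (≤ᵇ≡true⇒≤ {toℕ i} (∧≡true⇒ʳ {lookup B i} e)) (<⇒≤ d<c)))

rank-injective : (B : Subset n) (c d : Fin n) → lookup B c ≡ true → lookup B d ≡ true → rank B c ≡ rank B d → c ≡ d
rank-injective B c d c∈B d∈B e with <-cmp (toℕ c) (toℕ d)
... | tri< c<d _ _ = ⊥-elim (<⇒≢ (rank-mono-< B d c d∈B c<d) e)
... | tri≈ _ c≡d _ = Fin.toℕ-injective c≡d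
... | tri> _ _ d<c = ⊥-elim (<⇒≢ (rank-mono-< B c d c∈B d<c) (sym e))

-- The ranks of the elements of B below c are distinct values in 1..rank B c − 1;
-- if rank B c − 1 were missed, they could not all fit.
rank-predecessor : (B : Subset n) (c : Fin n) → lookup B c ≡ true → 2 ≤ rank B c →
  ∃ λ d → lookup B d ≡ true × toℕ d < toℕ c × rank B d ≡ rank B c ∸ 1
rank-predecessor {n} B c c∈B 2≤rank
  with Fin.any? (λ d → (lookup B d Bool.≟ true) ×-dec ((toℕ d <? toℕ c) ×-dec (rank B d ≟ rank B c ∸ 1)))
... | yes (d , d∈B , d<c , rank-d) = d , d∈B , d<c , rank-d
... | no  missed = ⊥-elim (≰∸1 (≤-pred (subst (2 ≤_) rank≡1+k 2≤rank)) fits)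
  where
  below : Fin n → Bool
  below d = lookup B d ∧ (toℕ d <ᵇ toℕ c)
  k : ℕ
  k = count below
  rank≡1+k : rank B c ≡ suc k
  rank≡1+k = trans (rank≡count B c) (count-remove c
    (λ i i≢c → cong (lookup B i ∧_) (≤ᵇ≡<ᵇ i i≢c))
    (∧≡true c∈B (≤⇒≤ᵇ≡true (≤-refl {toℕ c})))
    (trans (cong (lookup B c ∧_) (≥⇒<ᵇ≡false (≤-refl {toℕ c}))) (∧-zeroʳ _)))
    where
    ≤ᵇ≡<ᵇ : ∀ i → i ≢ c → (toℕ i ≤ᵇ toℕ c) ≡ (toℕ i <ᵇ toℕ c)
    ≤ᵇ≡<ᵇ i i≢c with <-cmp (toℕ i) (toℕ c)
    ... | tri< i<c _ _ rewrite ≤⇒≤ᵇ≡true (<⇒≤ i<c) | <⇒<ᵇ≡true i<c = refl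
    ... | tri≈ _ i≡c _ = ⊥-elim (i≢c (Fin.toℕ-injective i≡c))
    ... | tri> _ _ c<i rewrite >⇒≤ᵇ≡false c<i | ≥⇒<ᵇ≡false (<⇒≤ c<i) = refl
  rank-below : ∀ i → lookup B i ≡ true → toℕ i < toℕ c → rank B i ≤ k ∸ 1
  rank-below i i∈B i<c with m≤n⇒m<n∨m≡n (≤-pred (subst (rank B i <_) rank≡1+k (rank-mono-< B c i c∈B i<c)))
  ... | inj₂ rank-i≡k = ⊥-elim (missed (i , i∈B , i<c , trans rank-i≡k (cong (_∸ 1) (sym rank≡1+k))))
  ... | inj₁ rank-i<k = ∸-monoˡ-≤ 1 rank-i<k
  fits : k ≤ k ∸ 1
  fits = subst (k ≤_) (countUpTo-true (k ∸ 1)) (pigeonhole (k ∸ 1) below (rank B) (λ _ → true)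
           (λ i j bi bj → rank-injective B i j (∧≡true⇒ˡ bi) (∧≡true⇒ˡ bj))
           (λ i bi → rank-≥1 B i (∧≡true⇒ˡ bi)
                   , rank-below i (∧≡true⇒ˡ bi) (<ᵇ≡true⇒< (∧≡true⇒ʳ {lookup B i} bi)) , refl))
  ≰∸1 : ∀ {m} → 1 ≤ m → ¬ m ≤ m ∸ 1
  ≰∸1 {suc m} _ = 1+n≰n

-- φ on unit-interval parking functions

interval : ℕ → ℕ → List ℕ
interval j zero    = []
interval j (suc k) = suc j ∷ interval (suc j) k

applyUpTo≡interval : ∀ (f : ℕ → ℕ) j k → (∀ i → f i ≡ suc (j + i)) → applyUpTo f k ≡ interval j k
applyUpTo≡interval f j zero    _ = refl
applyUpTo≡interval f j (suc k) f≗ =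
  cong₂ _∷_ (trans (f≗ 0) (cong suc (+-identityʳ j)))
            (applyUpTo≡interval (f ∘′ suc) (suc j) k (λ i → trans (f≗ (suc i)) (cong suc (+-suc j i))))

module UnitInterval {n} (α spots : Vec ℕ n)
  (range : ∀ i → 1 ≤ lookup α i × lookup α i ≤ n)
  (parks : park n α ≡ just spots)
  (unit : ∀ i → lookup spots i ≤ suc (lookup α i)) where

  a p : Fin n → ℕ
  a i = lookup α i
  p i = lookup spots i

  parksAt : ParksAt n [] α spots
  parksAt = parkFrom-sound n [] α spots parks

  a≤p : ∀ i → a i ≤ p i
  a≤p i = CarParks.preference≤spot (parksAt i)

  p≤n : ∀ i → p i ≤ n
  p≤n i = CarParks.spot≤n (parksAt i)

  1≤p : ∀ i → 1 ≤ p i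
  1≤p i = ≤-trans (proj₁ (range i)) (a≤p i)

  p-injective : ∀ i j → p i ≡ p j → i ≡ j
  p-injective i j e with <-cmp (toℕ i) (toℕ j)
  ... | tri< i<j _ _ = ⊥-elim (CarParks.spot-free (parksAt j) (inj₂ (i , i<j , e)))
  ... | tri≈ _ i≡j _ = Fin.toℕ-injective i≡j
  ... | tri> _ _ j<i = ⊥-elim (CarParks.spot-free (parksAt i) (inj₂ (j , j<i , sym e)))

  earlier-car-at : ∀ i x → a i ≤ x → x < p i → ∃ λ j → toℕ j < toℕ i × p j ≡ x
  earlier-car-at i x a≤x x<p with CarParks.passed-occupied (parksAt i) x a≤x x<p
  ... | inj₁ ()
  ... | inj₂ earlier = earlier

  count∘p : ∀ h → count (h ∘′ p) ≡ countUpTo h n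
  count∘p = count∘bijection p p-injective (λ i → 1≤p i , p≤n i)

  p-surjective : ∀ j → 1 ≤ j → j ≤ n → ∃ λ c → p c ≡ j
  p-surjective j 1≤j j≤n =
    let (c , pc≡ᵇj) = count-witness {f = (_≡ᵇ j) ∘′ p} (subst (1 ≤_) (sym (count∘p (_≡ᵇ j))) j-counted)
    in c , ≡ᵇ≡true⇒≡ pc≡ᵇj
    where
    j-counted : 1 ≤ countUpTo (_≡ᵇ j) n
    j-counted rewrite countUpTo-remove (_≡ᵇ j) j n (≡⇒≡ᵇ≡true {j} refl) 1≤j j≤n = s≤s z≤n

  #spots≤ : ∀ k → k ≤ n → count (λ i → p i ≤ᵇ k) ≡ k
  #spots≤ k k≤n = trans (count∘p (_≤ᵇ k))
    (trans (countUpTo-cong n (λ j 1≤j _ → sym (cong (_∧ (j ≤ᵇ k)) (<⇒<ᵇ≡true 1≤j))))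
           (countUpTo-interval n 0 k k≤n))

  Breakpoint : ℕ → Set
  Breakpoint k = countLE α k ≡ k

  breakpoint? : (k : ℕ) → Dec (Breakpoint k)
  breakpoint? k = countLE α k ≟ k

  breakpoint-0 : Breakpoint 0
  breakpoint-0 = trans (countLE≡count α 0) (count-all-false _ (λ i → >⇒≤ᵇ≡false (proj₁ (range i))))

  breakpoint-n : Breakpoint n
  breakpoint-n = trans (countLE≡count α n) (count-all-true _ (λ i → ≤⇒≤ᵇ≡true (proj₂ (range i))))

  -- The cars preferring a spot ≤ p c − 1 are exactly those parked there, as car c is the only car
  -- that could be displaced past p c − 1 into p c.
  undisplaced⇒breakpoint : ∀ c → a c ≡ p c → Breakpoint (p c ∸ 1)
  undisplaced⇒breakpoint c ac≡pc = trans (countLE≡count α k) (≤-antisym upper lower)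
    where
    k : ℕ
    k = p c ∸ 1
    pc≡1+k : p c ≡ suc k
    pc≡1+k = sym (trans (+-comm 1 k) (m∸n+n≡m (1≤p c)))
    k≤n : k ≤ n
    k≤n = ≤-trans (n≤1+n k) (subst (_≤ n) pc≡1+k (p≤n c))
    preferred⇒parked : ∀ i → (a i ≤ᵇ k) ≡ true → (p i ≤ᵇ k) ≡ true
    preferred⇒parked i ai≤k with m≤n⇒m<n∨m≡n {p i} {suc k} (≤-trans (unit i) (s≤s (≤ᵇ≡true⇒≤ ai≤k)))
    ... | inj₁ (s≤s pi≤k) = ≤⇒≤ᵇ≡true pi≤k
    ... | inj₂ pi≡1+k rewrite p-injective i c (trans pi≡1+k (sym pc≡1+k)) =
      ⊥-elim (<⇒≱ (s≤s (≤ᵇ≡true⇒≤ ai≤k)) (≤-reflexive (trans (sym pc≡1+k) (sym ac≡pc))))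
    upper : count (λ i → a i ≤ᵇ k) ≤ k
    upper = subst (count (λ i → a i ≤ᵇ k) ≤_) (#spots≤ k k≤n) (count-mono preferred⇒parked)
    lower : k ≤ count (λ i → a i ≤ᵇ k)
    lower = subst (_≤ count (λ i → a i ≤ᵇ k)) (#spots≤ k k≤n)
      (count-mono (λ i pi≤k → ≤⇒≤ᵇ≡true (≤-trans (a≤p i) (≤ᵇ≡true⇒≤ pi≤k))))

  displaced⇒¬breakpoint : ∀ c → suc (a c) ≡ p c → suc (a c) ≤ countLE α (a c)
  displaced⇒¬breakpoint c 1+ac≡pc = subst (suc (a c) ≤_) (sym (countLE≡count α (a c)))
    (subst (_≤ count (λ i → a i ≤ᵇ a c)) (#spots≤ (suc (a c)) (subst (_≤ n) (sym 1+ac≡pc) (p≤n c)))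
      (count-mono parked⇒preferred))
    where
    parked⇒preferred : ∀ i → (p i ≤ᵇ suc (a c)) ≡ true → (a i ≤ᵇ a c) ≡ true
    parked⇒preferred i pi≤1+ac with m≤n⇒m<n∨m≡n {p i} {suc (a c)} (≤ᵇ≡true⇒≤ pi≤1+ac)
    ... | inj₁ (s≤s pi≤ac) = ≤⇒≤ᵇ≡true (≤-trans (a≤p i) pi≤ac)
    ... | inj₂ pi≡1+ac rewrite p-injective i c (trans pi≡1+ac 1+ac≡pc) = ≤⇒≤ᵇ≡true (≤-refl {a c})

  breakpoint⇒undisplaced : ∀ c → Breakpoint (p c ∸ 1) → a c ≡ p c
  breakpoint⇒undisplaced c bp with m≤n⇒m<n∨m≡n (a≤p c)
  ... | inj₂ ac≡pc = ac≡pc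
  ... | inj₁ ac<pc =
    let 1+ac≡pc = ≤-antisym ac<pc (unit c) in
    ⊥-elim (<⇒≱ (displaced⇒¬breakpoint c 1+ac≡pc) (≤-reflexive (subst Breakpoint (cong (_∸ 1) (sym 1+ac≡pc)) bp)))

  ¬breakpoint⇒displaced : ∀ c → ¬ Breakpoint (p c ∸ 1) → suc (a c) ≡ p c
  ¬breakpoint⇒displaced c ¬bp with m≤n⇒m<n∨m≡n (a≤p c)
  ... | inj₂ ac≡pc = ⊥-elim (¬bp (undisplaced⇒breakpoint c ac≡pc))
  ... | inj₁ ac<pc = ≤-antisym ac<pc (unit c)

  NoBreakpointIn : ℕ → ℕ → Set
  NoBreakpointIn lo b = ∀ x → lo < x → x < b → ¬ Breakpoint x

  -- As p c − 1 lies strictly inside (lo, b), car c is displaced, so spot p c − 1 was taken by an earlier car.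
  arrival-order : ∀ lo b → NoBreakpointIn lo b →
                  ∀ k c d → p c ≡ suc k + p d → lo < p d → p c ≤ b → toℕ d < toℕ c
  arrival-order lo b none k c d pc≡ lo<pd pc≤b =
    let (j , j<c , pj≡) = earlier-car-at c (k + p d) (≤-reflexive ac≡) (subst (k + p d <_) (sym pc≡) ≤-refl)
    in via k j pj≡ j<c (subst (_< b) (sym pj≡) (subst (_≤ b) pc≡ pc≤b))
    where
    ac≡ : a c ≡ k + p d
    ac≡ = suc-injective (trans (¬breakpoint⇒displaced c λ bp →
            none (k + p d) (≤-trans lo<pd (m≤n+m (p d) k)) (subst (_≤ b) pc≡ pc≤b) (subst Breakpoint (cong (_∸ 1) pc≡) bp))
          pc≡)
    via : ∀ k′ j → p j ≡ k′ + p d → toℕ j < toℕ c → p j < b → toℕ d < toℕ c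
    via zero     j pj≡ j<c _    rewrite p-injective j d pj≡ = j<c
    via (suc k′) j pj≡ j<c pj<b = <-trans (arrival-order lo b none k′ j d pj≡ lo<pd (<⇒≤ pj<b)) j<c

  lookup-carsIn : ∀ lo hi c → lookup (carsIn α lo hi) c ≡ inInterval lo hi (p c)
  lookup-carsIn lo hi c = trans (Vec.lookup-map c _ (spotsOf α)) (cong (λ v → inInterval lo hi (lookup v c)) spotsOf≡spots)
    where
    spotsOf≡spots : spotsOf α ≡ spots
    spotsOf≡spots rewrite parks = refl

  carsIn-∋ : ∀ lo hi c → lo < p c → p c ≤ hi → lookup (carsIn α lo hi) c ≡ true
  carsIn-∋ lo hi c lo<pc pc≤hi rewrite lookup-carsIn lo hi c | <⇒<ᵇ≡true lo<pc | ≤⇒≤ᵇ≡true pc≤hi = refl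

  carsIn-∌ : ∀ lo hi c → hi < p c → lookup (carsIn α lo hi) c ≡ false
  carsIn-∌ lo hi c hi<pc rewrite lookup-carsIn lo hi c | >⇒≤ᵇ≡false hi<pc = ∧-zeroʳ _

  ∣carsIn∣ : ∀ lo hi → hi ≤ n → ∣ carsIn α lo hi ∣ ≡ hi ∸ lo
  ∣carsIn∣ lo hi hi≤n = trans (∣∣≡count (carsIn α lo hi))
    (trans (count-cong (lookup-carsIn lo hi)) (trans (count∘p (inInterval lo hi)) (countUpTo-interval n lo hi hi≤n)))

  -- Since cars of (lo, b] arrive in the order of their spots, the rank of c is its spot minus lo.
  rank-carsIn : ∀ lo b c → NoBreakpointIn lo b → lo < p c → p c ≤ b → rank (carsIn α lo b) c ≡ p c ∸ lo
  rank-carsIn lo b c none lo<pc pc≤b =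
    trans (rank≡count (carsIn α lo b) c)
      (trans (count-cong (λ d → trans (cong (_∧ (toℕ d ≤ᵇ toℕ c)) (lookup-carsIn lo b d)) (before-c d)))
        (trans (count∘p (inInterval lo (p c))) (countUpTo-interval n lo (p c) (p≤n c))))
    where
    split : ∀ {x y} → x < y → y ≡ suc (y ∸ suc x) + x
    split {x} {y} x<y = sym (trans (sym (+-suc (y ∸ suc x) x)) (m∸n+n≡m x<y))
    before-c : ∀ d → (inInterval lo b (p d) ∧ (toℕ d ≤ᵇ toℕ c)) ≡ inInterval lo (p c) (p d)
    before-c d with lo <? p d
    ... | no  lo≮pd rewrite ≥⇒<ᵇ≡false (≮⇒≥ lo≮pd) = refl
    ... | yes lo<pd rewrite <⇒<ᵇ≡true lo<pd with <-cmp (p d) (p c)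
    ...   | tri< pd<pc _ _
      rewrite ≤⇒≤ᵇ≡true (≤-trans (<⇒≤ pd<pc) pc≤b) | ≤⇒≤ᵇ≡true (<⇒≤ pd<pc)
            | ≤⇒≤ᵇ≡true (<⇒≤ (arrival-order lo b none (p c ∸ suc (p d)) c d (split pd<pc) lo<pd pc≤b)) = refl
    ...   | tri≈ _ pd≡pc _
      rewrite p-injective d c pd≡pc | ≤⇒≤ᵇ≡true pc≤b | ≤⇒≤ᵇ≡true (≤-refl {toℕ c})
            | ≤⇒≤ᵇ≡true (≤-refl {p c}) = refl
    ...   | tri> _ _ pc<pd rewrite >⇒≤ᵇ≡false pc<pd with p d ≤? b
    ...     | no  pd≰b rewrite >⇒≤ᵇ≡false (≰⇒> pd≰b) = refl
    ...     | yes pd≤b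
      rewrite ≤⇒≤ᵇ≡true pd≤b
            | >⇒≤ᵇ≡false (arrival-order lo b none (p d ∸ suc (p c)) d c (split pc<pd) lo<pc pd≤b) = refl

  BreakpointsAbove : ℕ → List ℕ → Set
  BreakpointsAbove lo []       = lo ≡ n
  BreakpointsAbove lo (b ∷ bs) = lo < b × b ≤ n × Breakpoint b × NoBreakpointIn lo b × BreakpointsAbove b bs

  filter-interval-breakpoints : ∀ k j lo → j + k ≡ n → lo ≤ j → (∀ x → lo < x → x ≤ j → ¬ Breakpoint x) →
                                BreakpointsAbove lo (filter breakpoint? (interval j k))
  filter-interval-breakpoints zero j lo j+0≡n lo≤j none with m≤n⇒m<n∨m≡n lo≤j
  ... | inj₂ lo≡j = trans lo≡j (trans (sym (+-identityʳ j)) j+0≡n)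
  ... | inj₁ lo<j = ⊥-elim (none n (subst (lo <_) j≡n lo<j) (≤-reflexive (sym j≡n)) breakpoint-n)
    where
    j≡n : j ≡ n
    j≡n = trans (sym (+-identityʳ j)) j+0≡n
  filter-interval-breakpoints (suc k) j lo j+1+k≡n lo≤j none with breakpoint? (suc j)
  ... | yes bp rewrite Listₚ.filter-accept breakpoint? {suc j} {interval (suc j) k} bp =
    s≤s lo≤j , subst (suc j ≤_) j+1+k≡n (subst (_≤ j + suc k) (+-comm j 1) (+-monoʳ-≤ j (s≤s z≤n))) , bp ,
    (λ x lo<x x<1+j → none x lo<x (≤-pred x<1+j)) ,
    filter-interval-breakpoints k (suc j) (suc j) (trans (sym (+-suc j k)) j+1+k≡n) ≤-refl
      (λ x 1+j<x x≤1+j → ⊥-elim (<⇒≱ 1+j<x x≤1+j))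
  ... | no ¬bp rewrite Listₚ.filter-reject breakpoint? {suc j} {interval (suc j) k} ¬bp =
    filter-interval-breakpoints k (suc j) lo (trans (sym (+-suc j k)) j+1+k≡n) (≤-trans lo≤j (n≤1+n j)) none′
    where
    none′ : ∀ x → lo < x → x ≤ suc j → ¬ Breakpoint x
    none′ x lo<x x≤1+j with m≤n⇒m<n∨m≡n x≤1+j
    ... | inj₁ (s≤s x≤j) = none x lo<x x≤j
    ... | inj₂ refl      = ¬bp

  breakpoints-above-0 : BreakpointsAbove 0 (breakpoints α)
  breakpoints-above-0 =
    subst (BreakpointsAbove 0)
      (cong (filter breakpoint?) (sym (trans (Listₚ.map-upTo suc n) (applyUpTo≡interval suc 0 n (λ _ → refl)))))
      (filter-interval-breakpoints n 0 0 refl z≤n (λ x 0<x x≤0 → ⊥-elim (<⇒≱ 0<x x≤0)))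

  psiValue-recovers-preference : ∀ lo b c → Breakpoint lo → NoBreakpointIn lo b → lo < p c → p c ≤ b →
                                 psiValue lo (p c ∸ lo) ≡ a c
  psiValue-recovers-preference lo b c bp-lo none lo<pc pc≤b with m≤n⇒m<n∨m≡n lo<pc
  ... | inj₂ 1+lo≡pc = begin
    psiValue lo (p c ∸ lo)     ≡⟨ cong (λ x → psiValue lo (x ∸ lo)) (sym 1+lo≡pc) ⟩
    psiValue lo (suc lo ∸ lo)  ≡⟨ cong (psiValue lo) (m+n∸n≡m 1 lo) ⟩
    psiValue lo 1              ≡⟨ psiValue-1 lo ⟩
    suc lo                     ≡⟨ 1+lo≡pc ⟩
    p c                        ≡⟨ breakpoint⇒undisplaced c (subst Breakpoint (cong (_∸ 1) 1+lo≡pc) bp-lo) ⟨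
    a c                        ∎
    where open ≡-Reasoning
  ... | inj₁ 1+lo<pc = begin
    psiValue lo (p c ∸ lo)     ≡⟨ psiValue-≥2 lo (p c ∸ lo) 2≤pc-lo ⟩
    lo + (p c ∸ lo) ∸ 1        ≡⟨ cong (_∸ 1) (m+[n∸m]≡n (<⇒≤ lo<pc)) ⟩
    p c ∸ 1                    ≡⟨ cong (_∸ 1) (¬breakpoint⇒displaced c (none (p c ∸ 1) lo<pc-1 pc-1<b)) ⟨
    a c                        ∎
    where
    open ≡-Reasoning
    2≤pc-lo : 2 ≤ p c ∸ lo
    2≤pc-lo = subst (_≤ p c ∸ lo) (m+n∸n≡m 2 lo) (∸-monoˡ-≤ lo 1+lo<pc)
    lo<pc-1 : lo < p c ∸ 1
    lo<pc-1 = ∸-monoˡ-≤ 1 1+lo<pc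
    pc-1<b : p c ∸ 1 < b
    pc-1<b = ≤-trans (≤-reflexive (trans (+-comm 1 (p c ∸ 1)) (m∸n+n≡m (1≤p c)))) pc≤b

  psiAux-phiBlocks : ∀ bs lo → BreakpointsAbove lo bs → Breakpoint lo →
                     ∀ c → lo < p c → psiAux lo (phiBlocks α lo bs) c ≡ a c
  psiAux-phiBlocks []       lo refl _ c n<pc = ⊥-elim (<⇒≱ n<pc (p≤n c))
  psiAux-phiBlocks (b ∷ bs) lo (lo<b , b≤n , bp-b , none , above) bp-lo c lo<pc with p c ≤? b
  ... | yes pc≤b = begin
    psiAux lo (phiBlocks α lo (b ∷ bs)) c
      ≡⟨ psiAux-here lo (carsIn α lo b) (phiBlocks α b bs) c (carsIn-∋ lo b c lo<pc pc≤b) ⟩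
    psiValue lo (rank (carsIn α lo b) c)
      ≡⟨ cong (psiValue lo) (rank-carsIn lo b c none lo<pc pc≤b) ⟩
    psiValue lo (p c ∸ lo)
      ≡⟨ psiValue-recovers-preference lo b c bp-lo none lo<pc pc≤b ⟩
    a c ∎
    where open ≡-Reasoning
  ... | no pc≰b = begin
    psiAux lo (phiBlocks α lo (b ∷ bs)) c
      ≡⟨ psiAux-there lo (carsIn α lo b) (phiBlocks α b bs) c (carsIn-∌ lo b c (≰⇒> pc≰b)) ⟩
    psiAux (lo + ∣ carsIn α lo b ∣) (phiBlocks α b bs) c
      ≡⟨ cong (λ s → psiAux s (phiBlocks α b bs) c) lo+∣block∣≡b ⟩
    psiAux b (phiBlocks α b bs) c
      ≡⟨ psiAux-phiBlocks bs b above bp-b c (≰⇒> pc≰b) ⟩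
    a c ∎
    where
    open ≡-Reasoning
    lo+∣block∣≡b : lo + ∣ carsIn α lo b ∣ ≡ b
    lo+∣block∣≡b = trans (cong (lo +_) (∣carsIn∣ lo b b≤n)) (m+[n∸m]≡n (<⇒≤ lo<b))

  psi∘phi : psi (phi α) ≡ α
  psi∘phi = trans (Vec.tabulate-cong (λ c → psiAux-phiBlocks _ 0 breakpoints-above-0 breakpoint-0 c (1≤p c)))
                  (Vec.tabulate∘lookup α)

  phiBlocks-nonempty : ∀ bs lo → BreakpointsAbove lo bs → All Nonempty (phiBlocks α lo bs)
  phiBlocks-nonempty []       lo _                         = []
  phiBlocks-nonempty (b ∷ bs) lo (lo<b , b≤n , _ , _ , above) =
    (let (d , d∈block) = count-witness {f = lookup (carsIn α lo b)}
                           (subst (0 <_) (trans (sym (∣carsIn∣ lo b b≤n)) (∣∣≡count (carsIn α lo b)))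
                                  (m<n⇒0<n∸m lo<b))
     in d , Vec.lookup⇒[]= d (carsIn α lo b) d∈block)
    ∷ phiBlocks-nonempty bs b above

  phiBlocks-above : ∀ bs lo lo′ → lo ≤ lo′ → BreakpointsAbove lo′ bs →
                    All (λ B → ∀ d → lookup B d ≡ true → lo < p d) (phiBlocks α lo′ bs)
  phiBlocks-above []       lo lo′ _     _                      = []
  phiBlocks-above (b ∷ bs) lo lo′ lo≤lo′ (lo′<b , _ , _ , _ , above) =
    (λ d d∈block → ≤-trans (s≤s lo≤lo′) (<ᵇ≡true⇒< (∧≡true⇒ˡ (trans (sym (lookup-carsIn lo′ b d)) d∈block))))
    ∷ phiBlocks-above bs lo b (≤-trans lo≤lo′ (<⇒≤ lo′<b)) above

  carsIn-disjoint : ∀ lo b (C : Subset n) → (∀ d → lookup C d ≡ true → b < p d) → carsIn α lo b ∩ C ≡ ⊥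
  carsIn-disjoint lo b C above = lookup-extensionality _ _ λ d →
    trans (lookup-∩ (carsIn α lo b) C d) (trans (not-both d) (sym (lookup-⊥ d)))
    where
    not-both : ∀ d → (lookup (carsIn α lo b) d ∧ lookup C d) ≡ false
    not-both d with lookup C d in d∈C
    ... | true  rewrite carsIn-∌ lo b d (above d d∈C) = refl
    ... | false = ∧-zeroʳ _

  phiBlocks-disjoint : ∀ bs lo → BreakpointsAbove lo bs → AllPairs (λ A B → A ∩ B ≡ ⊥) (phiBlocks α lo bs)
  phiBlocks-disjoint []       lo _                       = []
  phiBlocks-disjoint (b ∷ bs) lo (_ , _ , _ , _ , above) =
    All.map (carsIn-disjoint lo b _) (phiBlocks-above bs b b ≤-refl above) ∷ phiBlocks-disjoint bs b above

  phiBlocks-cover : ∀ bs lo → BreakpointsAbove lo bs → ∀ c → lo < p c → lookup (⋃ (phiBlocks α lo bs)) c ≡ true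
  phiBlocks-cover []       lo refl c n<pc = ⊥-elim (<⇒≱ n<pc (p≤n c))
  phiBlocks-cover (b ∷ bs) lo (_ , _ , _ , _ , above) c lo<pc with p c ≤? b
  ... | yes pc≤b = trans (lookup-⋃-∷ (carsIn α lo b) (phiBlocks α b bs) c) (cong (_∨ _) (carsIn-∋ lo b c lo<pc pc≤b))
  ... | no  pc≰b = trans (lookup-⋃-∷ (carsIn α lo b) (phiBlocks α b bs) c)
                         (trans (cong (lookup (carsIn α lo b) c ∨_) (phiBlocks-cover bs b above c (≰⇒> pc≰b))) (∨-zeroʳ _))

  phi-IsOSP : IsOSP n (phi α)
  phi-IsOSP = phiBlocks-nonempty _ 0 breakpoints-above-0
            , phiBlocks-disjoint _ 0 breakpoints-above-0
            , lookup-extensionality _ _ (λ c → trans (phiBlocks-cover _ 0 breakpoints-above-0 c (1≤p c)) (sym (lookup-⊤ c)))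

-- ψ on ordered set partitions

Disjoint : Subset n → Subset n → Set
Disjoint A B = A ∩ B ≡ ⊥

totalSize : List (Subset n) → ℕ
totalSize []       = 0
totalSize (B ∷ Bs) = ∣ B ∣ + totalSize Bs

-- the spot in which ψ's parking function parks the car c
psiSpot : ℕ → List (Subset n) → Fin n → ℕ
psiSpot s []       c = 0
psiSpot s (B ∷ Bs) c = if lookup B c then s + rank B c else psiSpot (s + ∣ B ∣) Bs c

psiSpot-here : ∀ s (B : Subset n) Bs c → lookup B c ≡ true → psiSpot s (B ∷ Bs) c ≡ s + rank B c
psiSpot-here s B Bs c c∈B rewrite c∈B = refl

psiSpot-there : ∀ s (B : Subset n) Bs c → lookup B c ≡ false → psiSpot s (B ∷ Bs) c ≡ psiSpot (s + ∣ B ∣) Bs c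
psiSpot-there s B Bs c c∉B rewrite c∉B = refl

⋃-[]-∌ : ∀ (c : Fin n) → lookup (⋃ {n = n} []) c ≢ true
⋃-[]-∌ c c∈⋃ = false≢true (trans (sym (lookup-⊥ c)) c∈⋃)

⋃-∷⁻ : ∀ (B : Subset n) Bs c → lookup (⋃ (B ∷ Bs)) c ≡ true → lookup B c ≡ false → lookup (⋃ Bs) c ≡ true
⋃-∷⁻ B Bs c c∈⋃ c∉B = ∨≡true⇒ʳ (trans (sym (lookup-⋃-∷ B Bs c)) c∈⋃) c∉B

⋃-∷⁺ˡ : ∀ (B : Subset n) Bs c → lookup B c ≡ true → lookup (⋃ (B ∷ Bs)) c ≡ true
⋃-∷⁺ˡ B Bs c c∈B = trans (lookup-⋃-∷ B Bs c) (cong (_∨ lookup (⋃ Bs) c) c∈B)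

⋃-∷⁺ʳ : ∀ (B : Subset n) Bs c → lookup (⋃ Bs) c ≡ true → lookup (⋃ (B ∷ Bs)) c ≡ true
⋃-∷⁺ʳ B Bs c c∈⋃ = trans (lookup-⋃-∷ B Bs c) (trans (cong (lookup B c ∨_) c∈⋃) (∨-zeroʳ _))

disjoint-⋃-∌ : ∀ (B : Subset n) Bs c → All (Disjoint B) Bs → lookup (⋃ Bs) c ≡ true → lookup B c ≡ false
disjoint-⋃-∌ B []       c _                c∈⋃ = ⊥-elim (⋃-[]-∌ c c∈⋃)
disjoint-⋃-∌ B (C ∷ Cs) c (B∩C≡⊥ ∷ disj) c∈⋃ with lookup C c in c∈?C
... | false = disjoint-⋃-∌ B Cs c disj (⋃-∷⁻ C Cs c c∈⋃ c∈?C)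
... | true  = begin
  lookup B c                   ≡⟨ ∧-identityʳ (lookup B c) ⟨
  lookup B c ∧ true            ≡⟨ cong (lookup B c ∧_) c∈?C ⟨
  lookup B c ∧ lookup C c      ≡⟨ lookup-∩ B C c ⟨
  lookup (B ∩ C) c             ≡⟨ cong (λ v → lookup v c) B∩C≡⊥ ⟩
  lookup ⊥ c                   ≡⟨ lookup-⊥ c ⟩
  false                        ∎
  where open ≡-Reasoning

count-⋃ : (Bs : List (Subset n)) → AllPairs Disjoint Bs → count (lookup (⋃ Bs)) ≡ totalSize Bs
count-⋃ {n} []       _             = count-all-false (lookup (⊥ {n})) lookup-⊥
count-⋃     (B ∷ Bs) (disj ∷ disjs) =
  trans (count-cong (lookup-⋃-∷ B Bs))
    (trans (count-∨-disjoint (lookup B) (lookup (⋃ Bs)) not-both) (cong₂ _+_ (sym (∣∣≡count B)) (count-⋃ Bs disjs)))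
  where
  not-both : ∀ i → (lookup B i ∧ lookup (⋃ Bs) i) ≡ false
  not-both i with lookup (⋃ Bs) i in i∈⋃
  ... | true  rewrite disjoint-⋃-∌ B Bs i disj i∈⋃ = refl
  ... | false = ∧-zeroʳ _

psiSpot-> : (Bs : List (Subset n)) → ∀ s c → lookup (⋃ Bs) c ≡ true → s < psiSpot s Bs c
psiSpot-> []       s c c∈⋃ = ⊥-elim (⋃-[]-∌ c c∈⋃)
psiSpot-> (B ∷ Bs) s c c∈⋃ with lookup B c in c∈?B
... | true  = m<m+n s (rank-≥1 B c c∈?B)
... | false = ≤-trans (s≤s (m≤m+n s ∣ B ∣)) (psiSpot-> Bs (s + ∣ B ∣) c (⋃-∷⁻ B Bs c c∈⋃ c∈?B))

psiSpot-injective : (Bs : List (Subset n)) → ∀ s c d → lookup (⋃ Bs) c ≡ true → lookup (⋃ Bs) d ≡ true →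
                    psiSpot s Bs c ≡ psiSpot s Bs d → c ≡ d
psiSpot-injective []       s c d c∈⋃ _ _ = ⊥-elim (⋃-[]-∌ c c∈⋃)
psiSpot-injective (B ∷ Bs) s c d c∈⋃ d∈⋃ e with lookup B c in c∈?B | lookup B d in d∈?B
... | true  | true  = rank-injective B c d c∈?B d∈?B (+-cancelˡ-≡ s _ _ e)
... | true  | false = ⊥-elim (<⇒≱ (subst (s + ∣ B ∣ <_) (sym e) (psiSpot-> Bs (s + ∣ B ∣) d (⋃-∷⁻ B Bs d d∈⋃ d∈?B)))
                                   (+-monoʳ-≤ s (rank≤∣∣ B c)))
... | false | true  = ⊥-elim (<⇒≱ (subst (s + ∣ B ∣ <_) e (psiSpot-> Bs (s + ∣ B ∣) c (⋃-∷⁻ B Bs c c∈⋃ c∈?B)))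
                                   (+-monoʳ-≤ s (rank≤∣∣ B d)))
... | false | false = psiSpot-injective Bs (s + ∣ B ∣) c d (⋃-∷⁻ B Bs c c∈⋃ c∈?B) (⋃-∷⁻ B Bs d d∈⋃ d∈?B) e

module OrderedPartition {n} (P : List (Subset n)) (osp : IsOSP n P) where

  a q : Fin n → ℕ
  a c = psiAux 0 P c
  q c = psiSpot 0 P c

  ∈⋃P : ∀ c → lookup (⋃ P) c ≡ true
  ∈⋃P c = trans (cong (λ v → lookup v c) (proj₂ (proj₂ osp))) (lookup-⊤ c)

  -- Bs is a final segment of P whose preceding blocks have s elements in total
  record Suffix (s : ℕ) (Bs : List (Subset n)) : Set where
    field
      preference : ∀ c → lookup (⋃ Bs) c ≡ true → a c ≡ psiAux s Bs c
      spot       : ∀ c → lookup (⋃ Bs) c ≡ true → q c ≡ psiSpot s Bs c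
      earlier    : ∀ c → lookup (⋃ Bs) c ≡ false → q c ≤ s
      total      : s + totalSize Bs ≡ n
      disjoint   : AllPairs Disjoint Bs
      nonempty   : All Nonempty Bs

  open Suffix

  Suffix-P : Suffix 0 P
  Suffix-P = record
    { preference = λ _ _ → refl
    ; spot       = λ _ _ → refl
    ; earlier    = λ c c∉⋃ → ⊥-elim (false≢true (trans (sym c∉⋃) (∈⋃P c)))
    ; total      = trans (sym (count-⋃ P (proj₁ (proj₂ osp))))
                     (trans (cong (λ v → count (lookup v)) (proj₂ (proj₂ osp))) (count-all-true _ lookup-⊤))
    ; disjoint   = proj₁ (proj₂ osp)
    ; nonempty   = proj₁ osp
    }

  module _ {s} {B : Subset n} {Bs} (suffix : Suffix s (B ∷ Bs)) where

    head-preference : ∀ c → lookup B c ≡ true → a c ≡ psiValue s (rank B c)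
    head-preference c c∈B = trans (preference suffix c (⋃-∷⁺ˡ B Bs c c∈B)) (psiAux-here s B Bs c c∈B)

    head-spot : ∀ c → lookup B c ≡ true → q c ≡ s + rank B c
    head-spot c c∈B = trans (spot suffix c (⋃-∷⁺ˡ B Bs c c∈B)) (psiSpot-here s B Bs c c∈B)

    head-spot≤ : ∀ c → lookup B c ≡ true → q c ≤ s + ∣ B ∣
    head-spot≤ c c∈B = ≤-trans (≤-reflexive (head-spot c c∈B)) (+-monoʳ-≤ s (rank≤∣∣ B c))

    tail-spot> : ∀ c → lookup (⋃ (B ∷ Bs)) c ≡ true → lookup B c ≡ false → s + ∣ B ∣ < q c
    tail-spot> c c∈⋃ c∉B = subst (s + ∣ B ∣ <_) (sym (trans (spot suffix c c∈⋃) (psiSpot-there s B Bs c c∉B)))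
                                 (psiSpot-> Bs (s + ∣ B ∣) c (⋃-∷⁻ B Bs c c∈⋃ c∉B))

    head-end≤n : s + ∣ B ∣ ≤ n
    head-end≤n = ≤-trans (m≤m+n (s + ∣ B ∣) (totalSize Bs)) (≤-reflexive (trans (+-assoc s _ _) (total suffix)))

    Suffix-tail : Suffix (s + ∣ B ∣) Bs
    Suffix-tail = record
      { preference = λ c c∈⋃ → let c∉B = disjoint-⋃-∌ B Bs c (AllPairs.head (disjoint suffix)) c∈⋃ in
          trans (preference suffix c (⋃-∷⁺ʳ B Bs c c∈⋃)) (psiAux-there s B Bs c c∉B)
      ; spot       = λ c c∈⋃ → let c∉B = disjoint-⋃-∌ B Bs c (AllPairs.head (disjoint suffix)) c∈⋃ in
          trans (spot suffix c (⋃-∷⁺ʳ B Bs c c∈⋃)) (psiSpot-there s B Bs c c∉B)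
      ; earlier    = earlier′
      ; total      = trans (+-assoc s ∣ B ∣ (totalSize Bs)) (total suffix)
      ; disjoint   = AllPairs.tail (disjoint suffix)
      ; nonempty   = All.tail (nonempty suffix)
      }
      where
      earlier′ : ∀ c → lookup (⋃ Bs) c ≡ false → q c ≤ s + ∣ B ∣
      earlier′ c c∉⋃ with lookup B c in c∈?B
      ... | true  = head-spot≤ c c∈?B
      ... | false = ≤-trans (earlier suffix c (trans (lookup-⋃-∷ B Bs c) (trans (cong (_∨ lookup (⋃ Bs) c) c∈?B) c∉⋃)))
                            (m≤m+n s ∣ B ∣)

  record CarFacts (c : Fin n) : Set where
    field
      preference-range  : 1 ≤ a c × a c ≤ n
      preference≤spot   : a c ≤ q c
      spot≤n            : q c ≤ n
      spot≤1+preference : q c ≤ suc (a c)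
      passed-taken      : ∀ x → a c ≤ x → x < q c → ∃ λ j → toℕ j < toℕ c × q j ≡ x

  -- The t-th car of a block parks at s + t; for t ≥ 2 it prefers s + t − 1, where the (t−1)-th car parked.
  carFacts-head : ∀ {s B Bs} → Suffix s (B ∷ Bs) → ∀ c → lookup B c ≡ true → CarFacts c
  carFacts-head {s} {B} {Bs} suffix c c∈B = record
    { preference-range  = subst (1 ≤_) (sym ac≡) (psiValue-≥1 s t 1≤t)
                        , ≤-trans (≤-reflexive ac≡) (≤-trans (psiValue≤ s t) s+t≤n)
    ; preference≤spot   = subst₂ _≤_ (sym ac≡) (sym qc≡) (psiValue≤ s t)
    ; spot≤n            = subst (_≤ n) (sym qc≡) s+t≤n
    ; spot≤1+preference = subst₂ (λ x y → x ≤ suc y) (sym qc≡) (sym ac≡) (≤1+psiValue s t 1≤t)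
    ; passed-taken      = passed-taken′
    }
    where
    t : ℕ
    t = rank B c
    1≤t : 1 ≤ t
    1≤t = rank-≥1 B c c∈B
    ac≡ : a c ≡ psiValue s t
    ac≡ = head-preference suffix c c∈B
    qc≡ : q c ≡ s + t
    qc≡ = head-spot suffix c c∈B
    s+t≤n : s + t ≤ n
    s+t≤n = ≤-trans (+-monoʳ-≤ s (rank≤∣∣ B c)) (head-end≤n suffix)
    qc≡1+ : q c ≡ suc (s + (t ∸ 1))
    qc≡1+ = trans qc≡ (trans (cong (s +_) (sym (m+[n∸m]≡n 1≤t))) (+-suc s (t ∸ 1)))
    passed-taken′ : ∀ x → a c ≤ x → x < q c → ∃ λ j → toℕ j < toℕ c × q j ≡ x
    passed-taken′ x ac≤x x<qc with m≤n⇒m<n∨m≡n 1≤t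
    ... | inj₂ 1≡t = ⊥-elim (<⇒≱ x<qc (subst (_≤ x) (begin
      a c             ≡⟨ ac≡ ⟩
      psiValue s t    ≡⟨ cong (psiValue s) 1≡t ⟨
      psiValue s 1    ≡⟨ psiValue-1 s ⟩
      suc s           ≡⟨ +-comm 1 s ⟩
      s + 1           ≡⟨ cong (s +_) 1≡t ⟩
      s + t           ≡⟨ qc≡ ⟨
      q c             ∎) ac≤x))
      where open ≡-Reasoning
    ... | inj₁ 2≤t =
      let (d , d∈B , d<c , rank-d) = rank-predecessor B c c∈B 2≤t
          x≡ : x ≡ s + (t ∸ 1)
          x≡ = ≤-antisym (≤-pred (subst (x <_) qc≡1+ x<qc)) (subst (_≤ x) (trans ac≡ (psiValue-≥2′ s t 2≤t)) ac≤x)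
      in d , d<c , trans (head-spot suffix d d∈B) (trans (cong (s +_) rank-d) (sym x≡))

  carFacts : ∀ Bs s → Suffix s Bs → ∀ c → lookup (⋃ Bs) c ≡ true → CarFacts c
  carFacts []       s _      c c∈⋃ = ⊥-elim (⋃-[]-∌ c c∈⋃)
  carFacts (B ∷ Bs) s suffix c c∈⋃ with lookup B c in c∈?B
  ... | true  = carFacts-head suffix c c∈?B
  ... | false = carFacts Bs (s + ∣ B ∣) (Suffix-tail suffix) c (⋃-∷⁻ B Bs c c∈⋃ c∈?B)

  open CarFacts

  facts : ∀ c → CarFacts c
  facts c = carFacts P 0 Suffix-P c (∈⋃P c)

  spots : Vec ℕ n
  spots = tabulate q

  lookup-spots : ∀ c → lookup spots c ≡ q c
  lookup-spots = Vec.lookup∘tabulate q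

  lookup-psi : ∀ c → lookup (psi P) c ≡ a c
  lookup-psi = Vec.lookup∘tabulate (psiAux 0 P)

  q-injective : ∀ c d → q c ≡ q d → c ≡ d
  q-injective c d = psiSpot-injective P 0 c d (∈⋃P c) (∈⋃P d)

  psi-parks : park n (psi P) ≡ just spots
  psi-parks = parkFrom-complete n [] (psi P) spots λ i → record
    { preference≤spot = subst₂ _≤_ (sym (lookup-psi i)) (sym (lookup-spots i)) (preference≤spot (facts i))
    ; spot≤n          = subst (_≤ n) (sym (lookup-spots i)) (spot≤n (facts i))
    ; spot-free       = λ
        { (inj₁ ())
        ; (inj₂ (j , j<i , e)) →
            <-irrefl (cong toℕ (q-injective j i (trans (sym (lookup-spots j)) (trans e (lookup-spots i))))) j<i }
    ; passed-occupied = λ x ai≤x x<qi →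
        let (j , j<i , qj≡x) = passed-taken (facts i) x (subst (_≤ x) (lookup-psi i) ai≤x) (subst (x <_) (lookup-spots i) x<qi)
        in inj₂ (j , j<i , trans (lookup-spots j) qj≡x)
    }

  psi-range : ∀ i → 1 ≤ lookup (psi P) i × lookup (psi P) i ≤ n
  psi-range i = subst (λ x → 1 ≤ x × x ≤ n) (sym (lookup-psi i)) (preference-range (facts i))

  psi-unit : ∀ i → lookup spots i ≤ suc (lookup (psi P) i)
  psi-unit i = subst₂ (λ x y → x ≤ suc y) (sym (lookup-spots i)) (sym (lookup-psi i)) (spot≤1+preference (facts i))

  psi-IsUPF : IsUPF n (psi P)
  psi-IsUPF = lookup⇒All-toList (psi P) psi-range , spots , psi-parks
            , Pointwise.tabulate⁺ (λ i → spot≤1+preference (facts i))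

  module Ψ = UnitInterval (psi P) spots psi-range psi-parks psi-unit

  car-parked-at : ∀ {s B Bs} → Suffix s (B ∷ Bs) → ∀ x → s ≤ x → x < s + ∣ B ∣ →
                  ∃ λ e → lookup B e ≡ true × q e ≡ suc x
  car-parked-at {s} {B} {Bs} suffix x s≤x x<end with Ψ.p-surjective (suc x) (s≤s z≤n) (≤-trans x<end (head-end≤n suffix))
  ... | e , pe≡1+x = e , in-head (trans (sym (lookup-spots e)) pe≡1+x) , trans (sym (lookup-spots e)) pe≡1+x
    where
    in-head : q e ≡ suc x → lookup B e ≡ true
    in-head qe≡ with lookup (⋃ (B ∷ Bs)) e in e∈?⋃ | lookup B e in e∈?B
    ... | false | _     = ⊥-elim (<⇒≱ (s≤s s≤x) (subst (_≤ s) qe≡ (earlier suffix e e∈?⋃)))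
    ... | true  | true  = refl
    ... | true  | false = ⊥-elim (<⇒≱ (tail-spot> suffix e e∈?⋃ e∈?B) (subst (_≤ s + ∣ B ∣) (sym qe≡) x<end))

  -- The car e at spot x + 1 is the t-th of its block, and x is a breakpoint iff e is undisplaced iff t = 1.
  module InBlock {s B Bs} (suffix : Suffix s (B ∷ Bs)) (x : ℕ) (s≤x : s ≤ x) (x<end : x < s + ∣ B ∣) where

    e : Fin n
    e = proj₁ (car-parked-at suffix x s≤x x<end)

    e∈B : lookup B e ≡ true
    e∈B = proj₁ (proj₂ (car-parked-at suffix x s≤x x<end))

    t : ℕ
    t = rank B e

    pe≡1+x : Ψ.p e ≡ suc x
    pe≡1+x = trans (lookup-spots e) (proj₂ (proj₂ (car-parked-at suffix x s≤x x<end)))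

    pe≡s+t : Ψ.p e ≡ s + t
    pe≡s+t = trans (lookup-spots e) (head-spot suffix e e∈B)

    ae≡psiValue : Ψ.a e ≡ psiValue s t
    ae≡psiValue = trans (lookup-psi e) (head-preference suffix e e∈B)

    breakpoint⇒offset : Ψ.Breakpoint x → x ≡ s
    breakpoint⇒offset bp = suc-injective (begin
      suc x    ≡⟨ pe≡1+x ⟨
      Ψ.p e    ≡⟨ pe≡s+t ⟩
      s + t    ≡⟨ cong (s +_) t≡1 ⟩
      s + 1    ≡⟨ +-comm s 1 ⟩
      suc s    ∎)
      where
      open ≡-Reasoning
      t≡1 : t ≡ 1
      t≡1 = psiValue≡⇒t≡1 s t (rank-≥1 B e e∈B) (begin
        psiValue s t    ≡⟨ ae≡psiValue ⟨
        Ψ.a e           ≡⟨ Ψ.breakpoint⇒undisplaced e (subst Ψ.Breakpoint (cong (_∸ 1) (sym pe≡1+x)) bp) ⟩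
        Ψ.p e           ≡⟨ pe≡s+t ⟩
        s + t           ∎)

    offset⇒breakpoint : x ≡ s → Ψ.Breakpoint x
    offset⇒breakpoint x≡s = subst Ψ.Breakpoint (cong (_∸ 1) pe≡1+x) (Ψ.undisplaced⇒breakpoint e (begin
      Ψ.a e           ≡⟨ ae≡psiValue ⟩
      psiValue s t    ≡⟨ cong (psiValue s) t≡1 ⟩
      psiValue s 1    ≡⟨ psiValue-1 s ⟩
      suc s           ≡⟨ cong suc x≡s ⟨
      suc x           ≡⟨ pe≡1+x ⟨
      Ψ.p e           ∎))
      where
      open ≡-Reasoning
      t≡1 : t ≡ 1
      t≡1 = +-cancelˡ-≡ s _ _ (trans (sym pe≡s+t) (trans pe≡1+x (trans (cong suc x≡s) (+-comm 1 s))))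

  Suffix⇒breakpoint : ∀ {s} Bs → Suffix s Bs → Ψ.Breakpoint s
  Suffix⇒breakpoint {s} []       suffix = subst Ψ.Breakpoint (sym (trans (sym (+-identityʳ s)) (total suffix))) Ψ.breakpoint-n
  Suffix⇒breakpoint {s} (B ∷ Bs) suffix =
    InBlock.offset⇒breakpoint suffix s ≤-refl (m<m+n s (Nonempty⇒∣∣≥1 B (All.head (nonempty suffix)))) refl

  carsIn-head : ∀ {s B Bs} → Suffix s (B ∷ Bs) → carsIn (psi P) s (s + ∣ B ∣) ≡ B
  carsIn-head {s} {B} {Bs} suffix = lookup-extensionality _ _ λ d →
    trans (Ψ.lookup-carsIn s (s + ∣ B ∣) d) (trans (cong (inInterval s (s + ∣ B ∣)) (lookup-spots d)) (membership d))
    where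
    membership : ∀ d → inInterval s (s + ∣ B ∣) (q d) ≡ lookup B d
    membership d with lookup B d in d∈?B
    ... | true
      rewrite head-spot suffix d d∈?B | <⇒<ᵇ≡true (m<m+n s (rank-≥1 B d d∈?B)) | ≤⇒≤ᵇ≡true (+-monoʳ-≤ s (rank≤∣∣ B d))
      = refl
    ... | false with lookup (⋃ (B ∷ Bs)) d in d∈?⋃
    ...   | true  rewrite >⇒≤ᵇ≡false (tail-spot> suffix d d∈?⋃ d∈?B) = ∧-zeroʳ _
    ...   | false rewrite ≥⇒<ᵇ≡false (earlier suffix d d∈?⋃) = refl

  phiBlocks-psi : ∀ Bs s bs → Suffix s Bs → Ψ.BreakpointsAbove s bs → phiBlocks (psi P) s bs ≡ Bs
  phiBlocks-psi []       s []       _      _ = refl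
  phiBlocks-psi []       s (b ∷ bs) suffix (s<b , b≤n , _) =
    ⊥-elim (<⇒≱ (≤-trans s<b b≤n) (≤-reflexive (trans (sym (total suffix)) (+-identityʳ s))))
  phiBlocks-psi (B ∷ Bs) s []       suffix s≡n =
    ⊥-elim (<⇒≱ (m<m+n s (≤-trans (Nonempty⇒∣∣≥1 B (All.head (nonempty suffix))) (m≤m+n ∣ B ∣ (totalSize Bs))))
                (≤-reflexive (trans (total suffix) (sym s≡n))))
  phiBlocks-psi (B ∷ Bs) s (b ∷ bs) suffix (s<b , _ , bp-b , none , above) =
    cong₂ _∷_ (trans (cong (carsIn (psi P) s) b≡end) (carsIn-head suffix))
              (trans (cong (λ z → phiBlocks (psi P) z bs) b≡end)
                     (phiBlocks-psi Bs (s + ∣ B ∣) bs (Suffix-tail suffix)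
                                    (subst (λ z → Ψ.BreakpointsAbove z bs) b≡end above)))
    where
    b≡end : b ≡ s + ∣ B ∣
    b≡end with <-cmp b (s + ∣ B ∣)
    ... | tri< b<end _ _ = ⊥-elim (<⇒≢ s<b (sym (InBlock.breakpoint⇒offset suffix b (<⇒≤ s<b) b<end bp-b)))
    ... | tri≈ _ b≡end _ = b≡end
    ... | tri> _ _ end<b = ⊥-elim (none (s + ∣ B ∣) (m<m+n s (Nonempty⇒∣∣≥1 B (All.head (nonempty suffix)))) end<b
                                        (Suffix⇒breakpoint Bs (Suffix-tail suffix)))

  phi∘psi : phi (psi P) ≡ P
  phi∘psi = phiBlocks-psi P 0 (breakpoints (psi P)) Suffix-P Ψ.breakpoints-above-0

theorem3p6 : (n : ℕ) →
    ((P : List (Subset n)) → IsOSP n P → IsUPF n (psi P))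
    × ((α : Vec ℕ n) → IsUPF n α → IsOSP n (phi α))
    × ((P : List (Subset n)) → IsOSP n P → phi (psi P) ≡ P)
    × ((α : Vec ℕ n) → IsUPF n α → psi (phi α) ≡ α)
theorem3p6 n =
    (λ P osp → OrderedPartition.psi-IsUPF P osp)
  , (λ α (range , spots , parks , unit) →
       UnitInterval.phi-IsOSP α spots (All-toList⇒lookup α range) parks (Pointwise.lookup unit))
  , (λ P osp → OrderedPartition.phi∘psi P osp)
  , (λ α (range , spots , parks , unit) →
       UnitInterval.psi∘phi α spots (All-toList⇒lookup α range) parks (Pointwise.lookup unit))
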